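{- Let $I\in\mathcal{I}_k$, $h\in\mathbb{Z}$, $d,\lambda\in\mathbb{N}$, $1\le j\le\lambda$ and $\delta\in\{0,\dots,q^j-1\}$. Then $$G_\lambda^I(h,q^jd+\delta)=\frac1{q^j}\sum_{\varepsilon<q^j}\exp(-2\pi i h\varepsilon q^{ -\lambda})\,v^j(I,\varepsilon,\delta)\,G_{\lambda-j}^{T^j_{\varepsilon,\delta}(I)}(h,d).$$
   Context: Fix $q\ge2$, $m\ge1$, $F:\{0,\dots,q-1\}^m\to\mathbb{Z}$ with $F(0,\dots,0)=0$ such that $\sum_{j=1}^{m-1}F(nq^j)=0$ for all $n\in\mathbb{N}$, where $F(n):=F(\varepsilon_{m-1}(n),\dots,\varepsilon_0(n))$ and $\varepsilon_j(n)$ is the $j$-th base-$q$ digit of $n\ge0$ ($\varepsilon_j(n)=0$ for $j<0$). For $\lambda\ge0$ let $b_\lambda(n)=\sum_{j\in\mathbb{Z},\,j<\lambda}F(\varepsilon_{j+m-1}(n),\dots,\varepsilon_j(n))$ (which equals $\sum_{j=0}^{\lambda-1}F(\lfloor n/q^j\rfloor)$), extended $q^{\lambda+m-1}$-periodically to $\mathbb{Z}$. Fix $k\ge1$, $m'\ge1$, $\alpha_0,\dots,\alpha_{k-1}\in\{\frac0{m'},\dots,\frac{m'-1}{m'}\}$; $e(x)=\exp(2\pi ix)$. $\mathcal{I}_k$ is the set of integer vectors $(i_0,\dots,i_{k-1})$ with $0\le i_0<q^{m-1}$ and $i_{\ell-1}\le i_\ell\le i_{\ell-1}+q^{m-1}$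 for $1\le\ell\le k-1$. For $I\in\mathcal{I}_k$: $G_\lambda^I(h,d)=\frac1{q^\lambda}\sum_{0\le u<q^\lambda}e\bigl(\sum_{\ell=0}^{k-1}\alpha_\ell b_\lambda(q^{m-1}(u+\ell d)+i_\ell)-huq^{ -\lambda}\bigr)$. For $j\ge1$, $\varepsilon,\delta\in\{0,\dots,q^j-1\}$ and $I\in\mathcal{I}_k$: $T^j_{\varepsilon,\delta}(I)=\bigl(\lfloor (i_\ell+q^{m-1}(\varepsilon+\ell\delta))/q^j\rfloor\bigr)_{0\le\ell\le k-1}$ and $v^j(I,\varepsilon,\delta)=e\bigl(\sum_{\ell<k}\alpha_\ell\, b_j(i_\ell+q^{m-1}(\varepsilon+\ell\delta))\bigr)$. -}

module Defs where

open import Level using (Level)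
open import Data.Nat as ℕ using (ℕ; zero; suc; _^_; _∸_; NonZero)
open import Data.Nat.Properties using (m^n≢0)
open import Data.Nat.DivMod using (_/_; _mod_)
open import Data.Fin using (Fin; toℕ)
open import Data.Product using (_×_)
open import Relation.Binary.PropositionalEquality using (_≡_)
open import Data.Vec using (Vec; tabulate)
open import Data.Integer as ℤ using (ℤ; +_)
open import Data.Rational as ℚ using (ℚ)
open import Algebra.Bundles using (CommutativeRing)

digit : (q : ℕ) .{{_ : NonZero q}} → ℕ → ℕ → Fin q
digit q j n = (_/_ n (q ^ j) {{m^n≢0 q j}}) mod q

-- The digit vector (ε_{m-1}(n), …, ε_0(n)), first entry = ε_{m-1}(n).
digitVec : (q : ℕ) .{{_ : NonZero q}} (m : ℕ) → ℕ → Vec (Fin q) m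
digitVec q m n = tabulate (λ i → digit q (m ∸ 1 ∸ toℕ i) n)

Fn : (q : ℕ) .{{_ : NonZero q}} (m : ℕ) → (Vec (Fin q) m → ℤ) → ℕ → ℤ
Fn q m F n = F (digitVec q m n)

sumℤ : ℕ → ℕ → (ℕ → ℤ) → ℤ
sumℤ a zero    f = + 0
sumℤ a (suc l) f = f a ℤ.+ sumℤ (suc a) l f

b : (q : ℕ) .{{_ : NonZero q}} (m : ℕ) → (Vec (Fin q) m → ℤ) → ℕ → ℕ → ℤ
b q m F lam n = sumℤ 0 lam (λ j → Fn q m F (_/_ n (q ^ j) {{m^n≢0 q j}}))

sumFinℚ : (k : ℕ) → (Fin k → ℚ) → ℚ
sumFinℚ zero    f = ℚ.0ℚ
sumFinℚ (suc k) f = f Fin.zero ℚ.+ sumFinℚ k (λ i → f (Fin.suc i))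

InI : (q m k : ℕ) → (Fin k → ℕ) → Set
InI q m k I =
  (∀ (ℓ : Fin k) → toℕ ℓ ≡ 0 → I ℓ ℕ.< q ^ (m ∸ 1)) ×
  (∀ (ℓ ℓ' : Fin k) → suc (toℕ ℓ) ≡ toℕ ℓ' →
      (I ℓ ℕ.≤ I ℓ') × (I ℓ' ℕ.≤ I ℓ ℕ.+ q ^ (m ∸ 1)))

-- Σ_{ℓ<k} α_ℓ b_λ(x_ℓ), with α_ℓ = a_ℓ / m'
phaseB : (q : ℕ) .{{_ : NonZero q}} (m : ℕ) (F : Vec (Fin q) m → ℤ)
         (m' : ℕ) .{{_ : NonZero m'}} (k : ℕ) (a : Fin k → Fin m')
         (lam : ℕ) (x : Fin k → ℕ) → ℚ
phaseB q m F m' k a lam x =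
  sumFinℚ k (λ ℓ → ((+ toℕ (a ℓ)) ℤ.* b q m F lam (x ℓ)) ℚ./ m')

T : (q : ℕ) .{{_ : NonZero q}} (m k j ε δ : ℕ) → (Fin k → ℕ) → (Fin k → ℕ)
T q m k j ε δ I ℓ =
  _/_ (I ℓ ℕ.+ q ^ (m ∸ 1) ℕ.* (ε ℕ.+ toℕ ℓ ℕ.* δ)) (q ^ j) {{m^n≢0 q j}}

-- Ring-valued part.  e : ℚ → R plays the role of x ↦ exp(2πix).

module _ {c ℓr : Level} (R : CommutativeRing c ℓr) where
  open CommutativeRing R

  natR : ℕ → Carrier
  natR zero    = 0#
  natR (suc n) = 1# + natR n

  powR : Carrier → ℕ → Carrier
  powR x zero    = 1#
  powR x (suc n) = x * powR x n

  sumR : ℕ → (ℕ → Carrier) → Carrier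
  sumR zero    f = 0#
  sumR (suc n) f = sumR n f + f n

  IsCharacter : (ℚ → Carrier) → Set ℓr
  IsCharacter e = (∀ x y → e (x ℚ.+ y) ≈ e x * e y) × (∀ (z : ℤ) → e (z ℚ./ 1) ≈ 1#)

  -- G^I_λ(h,d) = q^{-λ} Σ_{u<q^λ} e(Σ_ℓ α_ℓ b_λ(q^{m-1}(u+ℓd)+i_ℓ) − h u q^{-λ}),
  -- with qinv playing the role of 1/q.
  G : (q : ℕ) .{{_ : NonZero q}} (m : ℕ) (F : Vec (Fin q) m → ℤ)
      (m' : ℕ) .{{_ : NonZero m'}} (k : ℕ) (a : Fin k → Fin m')
      (e : ℚ → Carrier) (qinv : Carrier)
      (lam : ℕ) (I : Fin k → ℕ) (h : ℤ) (d : ℕ) → Carrier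
  G q m F m' k a e qinv lam I h d =
    powR qinv lam *
    sumR (q ^ lam) (λ u →
      e (phaseB q m F m' k a lam
              (λ ℓ → q ^ (m ∸ 1) ℕ.* (u ℕ.+ toℕ ℓ ℕ.* d) ℕ.+ I ℓ)
         ℚ.- ((h ℤ.* + u) ℚ./ (q ^ lam)) {{m^n≢0 q lam}}))

  v : (q : ℕ) .{{_ : NonZero q}} (m : ℕ) (F : Vec (Fin q) m → ℤ)
      (m' : ℕ) .{{_ : NonZero m'}} (k : ℕ) (a : Fin k → Fin m')
      (e : ℚ → Carrier) (j : ℕ) (I : Fin k → ℕ) (ε δ : ℕ) → Carrier
  v q m F m' k a e j I ε δ =
    e (phaseB q m F m' k a j (λ ℓ → I ℓ ℕ.+ q ^ (m ∸ 1) ℕ.* (ε ℕ.+ toℕ ℓ ℕ.* δ)))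

module Submission where

-- Put P = q^j, M = q^(λ-j), Q = q^(m-1), D = P d + δ, and write
-- each u < q^λ = P M uniquely as u = ε + P u' with ε < P and u' < M.  Then
--   (a) the sum over u becomes a double sum over ε and u'          (sumR-digits);
--   (b) the ℓ-th argument of b_λ is x = N + P Q (u' + ℓ d) with
--       N = i_ℓ + Q (ε + ℓ δ), and b_λ(x) = b_j(x) + b_(λ-j)(⌊x/P⌋)   (b-split);
--       b_j(x) = b_j(N) since b_j only reads digits below j + m - 1   (b-periodic),
--       and ⌊x/P⌋ = Q (u' + ℓ d) + T^j_{ε,δ}(I)_ℓ;
--   (c) h u / q^λ = h ε / q^λ + h u' / q^(λ-j)                       (fracSplit).
-- As e is additive, every summand of G_λ^I(h, P d + δ) therefore factors as
-- e(-hε/q^λ) · v^j(I,ε,δ) · (the u'-th summand of G_(λ-j)^(T(I))(h,d)), and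
-- q^(-λ) = q^(-j) q^(-(λ-j)) finishes the proof.  The identity is purely formal:
-- of the hypotheses of lemma10 only the additivity of e is used.

open import Defs
open import Level using (Level)
open import Data.Product using (_,_)
open import Data.Nat as ℕ using (ℕ; zero; suc; _^_; _∸_; _≤_; _<_; NonZero)
open import Data.Nat.Properties using (m^n≢0)
import Data.Nat.Properties as ℕP
open import Data.Nat.DivMod using (_mod_; _/_)
import Data.Nat.DivMod as ℕD
open import Data.Nat.Divisibility using (divides)
open import Data.Fin using (Fin; toℕ)
import Data.Fin.Properties as FinP
open import Data.Vec using (Vec; replicate)
import Data.Vec.Properties as VecP
open import Data.Integer as ℤ using (ℤ; +_)
import Data.Integer.Properties as ℤP
open import Data.Integer.Tactic.RingSolver using (solve-∀)
import Data.Nat.Tactic.RingSolver as ℕSolver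
open import Data.Rational as ℚ using (ℚ; toℚᵘ)
import Data.Rational.Properties as ℚP
import Data.Rational.Unnormalised as U
import Data.Rational.Unnormalised.Properties as UP
open import Data.Rational.Solver using (module +-*-Solver)
open +-*-Solver using (solve; _:+_; _:-_; :-_; _:=_)
open import Algebra.Bundles using (CommutativeRing)
import Relation.Binary.Reasoning.Setoid as SetoidReasoning
open import Relation.Binary.PropositionalEquality
  using (_≡_; refl; sym; trans; cong; cong₂; module ≡-Reasoning)

toℚᵘ-/ : ∀ i n .{{_ : NonZero n}} → toℚᵘ (i ℚ./ n) U.≃ (i U./ n)
toℚᵘ-/ i (suc n) = ℚP.toℚᵘ-fromℚᵘ (U.mkℚᵘ i n)

/-cross : ∀ i n j n' .{{_ : NonZero n}} .{{_ : NonZero n'}} →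
          i ℤ.* + n' ≡ j ℤ.* + n → i ℚ./ n ≡ j ℚ./ n'
/-cross i n@(suc _) j n'@(suc _) eq = ℚP.toℚᵘ-injective
  (UP.≃-trans (toℚᵘ-/ i n) (UP.≃-trans (U.*≡* eq) (UP.≃-sym (toℚᵘ-/ j n'))))

/-+ : ∀ i n j n' .{{_ : NonZero n}} .{{_ : NonZero n'}} .{{_ : NonZero (n ℕ.* n')}} →
      i ℚ./ n ℚ.+ j ℚ./ n' ≡ (i ℤ.* + n' ℤ.+ j ℤ.* + n) ℚ./ (n ℕ.* n')
/-+ i (suc n) j (suc n') = ℚP.toℚᵘ-injective
  (UP.≃-trans (ℚP.toℚᵘ-homo-+ (i ℚ./ suc n) (j ℚ./ suc n'))
    (UP.≃-trans (UP.+-cong (toℚᵘ-/ i (suc n)) (toℚᵘ-/ j (suc n')))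
      (UP.≃-sym (toℚᵘ-/ _ (suc n ℕ.* suc n')))))

/-distribʳ-+ : ∀ i j n .{{_ : NonZero n}} → (i ℤ.+ j) ℚ./ n ≡ i ℚ./ n ℚ.+ j ℚ./ n
/-distribʳ-+ i j n@(suc _) = trans
  (/-cross (i ℤ.+ j) n (i ℤ.* + n ℤ.+ j ℤ.* + n) (n ℕ.* n) cross)
  (sym (/-+ i n j n))
  where
  distrib : ∀ a b c → (a ℤ.+ b) ℤ.* (c ℤ.* c) ≡ (a ℤ.* c ℤ.+ b ℤ.* c) ℤ.* c
  distrib = solve-∀
  cross : (i ℤ.+ j) ℤ.* + (n ℕ.* n) ≡ (i ℤ.* + n ℤ.+ j ℤ.* + n) ℤ.* + n
  cross rewrite ℤP.pos-* n n = distrib i j (+ n)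

/-cancel : ∀ i c n .{{_ : NonZero n}} .{{_ : NonZero (c ℕ.* n)}} →
           (i ℤ.* + c) ℚ./ (c ℕ.* n) ≡ i ℚ./ n
/-cancel i c n = /-cross (i ℤ.* + c) (c ℕ.* n) i n (begin
  i ℤ.* + c ℤ.* + n     ≡⟨ ℤP.*-assoc i (+ c) (+ n) ⟩
  i ℤ.* (+ c ℤ.* + n)   ≡⟨ cong (i ℤ.*_) (ℤP.pos-* c n) ⟨
  i ℤ.* + (c ℕ.* n)     ∎)
  where open ≡-Reasoning

fracSplit : ∀ h ε u A M L .{{_ : NonZero M}} .{{_ : NonZero L}} → L ≡ A ℕ.* M →
            (h ℤ.* + (ε ℕ.+ A ℕ.* u)) ℚ./ L ≡ (h ℤ.* + ε) ℚ./ L ℚ.+ (h ℤ.* + u) ℚ./ M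
fracSplit h ε u A M L refl = begin
  (h ℤ.* + (ε ℕ.+ A ℕ.* u)) ℚ./ L
    ≡⟨ cong (λ z → z ℚ./ L) numerator ⟩
  (h ℤ.* + ε ℤ.+ (h ℤ.* + u) ℤ.* + A) ℚ./ L
    ≡⟨ /-distribʳ-+ (h ℤ.* + ε) ((h ℤ.* + u) ℤ.* + A) L ⟩
  (h ℤ.* + ε) ℚ./ L ℚ.+ ((h ℤ.* + u) ℤ.* + A) ℚ./ L
    ≡⟨ cong ((h ℤ.* + ε) ℚ./ L ℚ.+_) (/-cancel (h ℤ.* + u) A M) ⟩
  (h ℤ.* + ε) ℚ./ L ℚ.+ (h ℤ.* + u) ℚ./ M ∎
  where
  open ≡-Reasoning
  expand : ∀ h e a u → h ℤ.* (e ℤ.+ a ℤ.* u) ≡ h ℤ.* e ℤ.+ (h ℤ.* u) ℤ.* a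
  expand = solve-∀
  numerator : h ℤ.* + (ε ℕ.+ A ℕ.* u) ≡ h ℤ.* + ε ℤ.+ (h ℤ.* + u) ℤ.* + A
  numerator = trans
    (cong (h ℤ.*_) (trans (ℤP.pos-+ ε (A ℕ.* u)) (cong (λ z → + ε ℤ.+ z) (ℤP.pos-* A u))))
    (expand h (+ ε) (+ A) (+ u))

module FiniteSums {c ℓr : Level} (R : CommutativeRing c ℓr) where
  open CommutativeRing R
    renaming (refl to ≈-refl; sym to ≈-sym; trans to ≈-trans; reflexive to ≈-reflexive)
  open SetoidReasoning setoid

  sumR-cong : ∀ n {f g : ℕ → Carrier} → (∀ i → f i ≈ g i) → sumR R n f ≈ sumR R n g
  sumR-cong zero    f≈g = ≈-refl
  sumR-cong (suc n) f≈g = +-cong (sumR-cong n f≈g) (f≈g n)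

  sumR-length : ∀ {n n'} (f : ℕ → Carrier) → n ≡ n' → sumR R n f ≈ sumR R n' f
  sumR-length f refl = ≈-refl

  sumR-0# : ∀ n → sumR R n (λ _ → 0#) ≈ 0#
  sumR-0# zero    = ≈-refl
  sumR-0# (suc n) = ≈-trans (+-identityʳ _) (sumR-0# n)

  sumR-+ : ∀ n (f g : ℕ → Carrier) →
           sumR R n (λ i → f i + g i) ≈ sumR R n f + sumR R n g
  sumR-+ zero    f g = ≈-sym (+-identityʳ 0#)
  sumR-+ (suc n) f g = begin
    sumR R n (λ i → f i + g i) + (f n + g n) ≈⟨ +-congʳ (sumR-+ n f g) ⟩
    (sumR R n f + sumR R n g) + (f n + g n) ≈⟨ +-assoc _ _ _ ⟩
    sumR R n f + (sumR R n g + (f n + g n)) ≈⟨ +-congˡ (≈-sym (+-assoc _ _ _)) ⟩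
    sumR R n f + ((sumR R n g + f n) + g n) ≈⟨ +-congˡ (+-congʳ (+-comm _ _)) ⟩
    sumR R n f + ((f n + sumR R n g) + g n) ≈⟨ +-congˡ (+-assoc _ _ _) ⟩
    sumR R n f + (f n + (sumR R n g + g n)) ≈⟨ ≈-sym (+-assoc _ _ _) ⟩
    (sumR R n f + f n) + (sumR R n g + g n) ∎

  sumR-++ : ∀ n p (f : ℕ → Carrier) →
            sumR R (n ℕ.+ p) f ≈ sumR R n f + sumR R p (λ i → f (n ℕ.+ i))
  sumR-++ n zero    f = ≈-trans (sumR-length f (ℕP.+-identityʳ n)) (≈-sym (+-identityʳ _))
  sumR-++ n (suc p) f = begin
    sumR R (n ℕ.+ suc p) f                                  ≈⟨ sumR-length f (ℕP.+-suc n p) ⟩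
    sumR R (n ℕ.+ p) f + f (n ℕ.+ p)                        ≈⟨ +-congʳ (sumR-++ n p f) ⟩
    (sumR R n f + sumR R p (λ i → f (n ℕ.+ i))) + f (n ℕ.+ p) ≈⟨ +-assoc _ _ _ ⟩
    sumR R n f + sumR R (suc p) (λ i → f (n ℕ.+ i))         ∎

  sumR-*-distribˡ : ∀ n x (f : ℕ → Carrier) → x * sumR R n f ≈ sumR R n (λ i → x * f i)
  sumR-*-distribˡ zero    x f = zeroʳ x
  sumR-*-distribˡ (suc n) x f = ≈-trans (distribˡ x _ _) (+-congʳ (sumR-*-distribˡ n x f))

  sumR-digits : ∀ A M (f : ℕ → Carrier) →
    sumR R (A ℕ.* M) f ≈ sumR R A (λ ε → sumR R M (λ u' → f (ε ℕ.+ A ℕ.* u')))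
  sumR-digits A zero    f = ≈-trans (sumR-length f (ℕP.*-zeroʳ A)) (≈-sym (sumR-0# A))
  sumR-digits A (suc M) f = begin
    sumR R (A ℕ.* suc M) f
      ≈⟨ sumR-length f (trans (ℕP.*-suc A M) (ℕP.+-comm A (A ℕ.* M))) ⟩
    sumR R (A ℕ.* M ℕ.+ A) f
      ≈⟨ sumR-++ (A ℕ.* M) A f ⟩
    sumR R (A ℕ.* M) f + sumR R A (λ ε → f (A ℕ.* M ℕ.+ ε))
      ≈⟨ +-cong (sumR-digits A M f)
                (sumR-cong A (λ ε → ≈-reflexive (cong f (ℕP.+-comm (A ℕ.* M) ε)))) ⟩
    sumR R A (λ ε → sumR R M (λ u' → f (ε ℕ.+ A ℕ.* u'))) + sumR R A (λ ε → f (ε ℕ.+ A ℕ.* M))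
      ≈⟨ ≈-sym (sumR-+ A _ _) ⟩
    sumR R A (λ ε → sumR R (suc M) (λ u' → f (ε ℕ.+ A ℕ.* u'))) ∎

  powR-+ : ∀ x a b → powR R x (a ℕ.+ b) ≈ powR R x a * powR R x b
  powR-+ x zero    b = ≈-sym (*-identityˡ _)
  powR-+ x (suc a) b = ≈-trans (*-congˡ (powR-+ x a b)) (≈-sym (*-assoc _ _ _))

sumℤ-cong : ∀ a a' l {f g : ℕ → ℤ} → (∀ i → i < l → f (a ℕ.+ i) ≡ g (a' ℕ.+ i)) →
            sumℤ a l f ≡ sumℤ a' l g
sumℤ-cong a a' zero    f≡g = refl
sumℤ-cong a a' (suc l) {f} {g} f≡g = cong₂ ℤ._+_ head (sumℤ-cong (suc a) (suc a') l tail)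
  where
  head : f a ≡ g a'
  head = trans (cong f (sym (ℕP.+-identityʳ a)))
           (trans (f≡g 0 (ℕ.s≤s ℕ.z≤n)) (cong g (ℕP.+-identityʳ a')))
  tail : ∀ i → i < l → f (suc a ℕ.+ i) ≡ g (suc a' ℕ.+ i)
  tail i i<l = trans (cong f (sym (ℕP.+-suc a i)))
                 (trans (f≡g (suc i) (ℕ.s≤s i<l)) (cong g (ℕP.+-suc a' i)))

sumℤ-++ : ∀ a l₁ l₂ (f : ℕ → ℤ) →
          sumℤ a (l₁ ℕ.+ l₂) f ≡ sumℤ a l₁ f ℤ.+ sumℤ (a ℕ.+ l₁) l₂ f
sumℤ-++ a zero     l₂ f = trans (cong (λ z → sumℤ z l₂ f) (sym (ℕP.+-identityʳ a)))
                                (sym (ℤP.+-identityˡ _))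
sumℤ-++ a (suc l₁) l₂ f = trans
  (cong (λ z → f a ℤ.+ z) (trans (sumℤ-++ (suc a) l₁ l₂ f)
    (cong (λ z → sumℤ (suc a) l₁ f ℤ.+ sumℤ z l₂ f) (sym (ℕP.+-suc a l₁)))))
  (sym (ℤP.+-assoc (f a) _ _))

sumFinℚ-cong : ∀ k {f g : Fin k → ℚ} → (∀ ℓ → f ℓ ≡ g ℓ) → sumFinℚ k f ≡ sumFinℚ k g
sumFinℚ-cong zero    f≡g = refl
sumFinℚ-cong (suc k) f≡g = cong₂ ℚ._+_ (f≡g Fin.zero) (sumFinℚ-cong k (λ i → f≡g (Fin.suc i)))

sumFinℚ-+ : ∀ k (f g : Fin k → ℚ) →
            sumFinℚ k (λ ℓ → f ℓ ℚ.+ g ℓ) ≡ sumFinℚ k f ℚ.+ sumFinℚ k g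
sumFinℚ-+ zero    f g = refl
sumFinℚ-+ (suc k) f g = trans
  (cong ((f Fin.zero ℚ.+ g Fin.zero) ℚ.+_) (sumFinℚ-+ k (λ i → f (Fin.suc i)) (λ i → g (Fin.suc i))))
  (interchange (f Fin.zero) (g Fin.zero) _ _)
  where
  interchange : ∀ a b c d → (a ℚ.+ b) ℚ.+ (c ℚ.+ d) ≡ (a ℚ.+ c) ℚ.+ (b ℚ.+ d)
  interchange = solve 4 (λ a b c d → (a :+ b) :+ (c :+ d) := (a :+ c) :+ (b :+ d)) refl

module Digits (q : ℕ) .{{_ : NonZero q}} (m : ℕ) (F : Vec (Fin q) m → ℤ) where

  infixl 7 _/q^_
  _/q^_ : ℕ → ℕ → ℕ
  x /q^ p = _/_ x (q ^ p) {{m^n≢0 q p}}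

  /q^-/q^ : ∀ x a c → x /q^ a /q^ c ≡ x /q^ (a ℕ.+ c)
  /q^-/q^ x a c = trans
    (ℕD.m/n/o≡m/[n*o] x (q ^ a) (q ^ c) {{m^n≢0 q a}} {{m^n≢0 q c}} {{q^a*q^c≢0}})
    (ℕD./-congʳ {{q^a*q^c≢0}} {{m^n≢0 q (a ℕ.+ c)}} (sym (ℕP.^-distribˡ-+-* q a c)))
    where
    q^a*q^c≢0 : NonZero (q ^ a ℕ.* q ^ c)
    q^a*q^c≢0 = ℕP.m*n≢0 (q ^ a) (q ^ c) {{m^n≢0 q a}} {{m^n≢0 q c}}

  /q^-+-* : ∀ N Y p → (N ℕ.+ q ^ p ℕ.* Y) /q^ p ≡ N /q^ p ℕ.+ Y
  /q^-+-* N Y p = trans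
    (ℕD.+-distrib-/-∣ʳ N {{m^n≢0 q p}} (divides Y (ℕP.*-comm (q ^ p) Y)))
    (cong (N /q^ p ℕ.+_) (trans (cong (_/q^ p) (ℕP.*-comm (q ^ p) Y))
                                (ℕD.m*n/n≡m Y (q ^ p) {{m^n≢0 q p}})))

  digit-+-high : ∀ N Z {s p} → s < p → digit q s (N ℕ.+ q ^ p ℕ.* Z) ≡ digit q s N
  digit-+-high N Z {s} {p} s<p =
    trans (cong (λ x → (x /q^ s) mod q) split)
      (trans (cong (_mod q) (/q^-+-* N (q ^ r ℕ.* Z ℕ.* q) s))
        (FinP.fromℕ<-cong _ _ (ℕD.[m+kn]%n≡m%n (N /q^ s) (q ^ r ℕ.* Z) q) _ _))
    where
    r = p ∸ suc s
    arrange : ∀ a b c z → a ℕ.* (b ℕ.* c) ℕ.* z ≡ a ℕ.* (c ℕ.* z ℕ.* b)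
    arrange = ℕSolver.solve-∀
    split : N ℕ.+ q ^ p ℕ.* Z ≡ N ℕ.+ q ^ s ℕ.* (q ^ r ℕ.* Z ℕ.* q)
    split = trans
      (cong (λ t → N ℕ.+ q ^ t ℕ.* Z) (sym (trans (ℕP.+-suc s r) (ℕP.m+[n∸m]≡n s<p))))
      (cong (N ℕ.+_) (trans (cong (ℕ._* Z) (ℕP.^-distribˡ-+-* q s (suc r)))
                            (arrange (q ^ s) q (q ^ r) Z)))

  -- F(n) only reads the digits of n in positions 0, …, m-1.
  Fn-+-high : ∀ N Z {p} → m ∸ 1 < p → Fn q m F (N ℕ.+ q ^ p ℕ.* Z) ≡ Fn q m F N
  Fn-+-high N Z m-1<p = cong F (VecP.tabulate-cong (λ t →
    digit-+-high N Z (ℕP.≤-<-trans (ℕP.m∸n≤m (m ∸ 1) (toℕ t)) m-1<p)))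

  /q^-+-high : ∀ N Z {i p} → i ≤ p → (N ℕ.+ q ^ p ℕ.* Z) /q^ i ≡ N /q^ i ℕ.+ q ^ (p ∸ i) ℕ.* Z
  /q^-+-high N Z {i} {p} i≤p = trans (cong (λ y → (N ℕ.+ y) /q^ i) high) (/q^-+-* N _ i)
    where
    high : q ^ p ℕ.* Z ≡ q ^ i ℕ.* (q ^ (p ∸ i) ℕ.* Z)
    high = trans (cong (λ t → q ^ t ℕ.* Z) (sym (ℕP.m+[n∸m]≡n i≤p)))
             (trans (cong (ℕ._* Z) (ℕP.^-distribˡ-+-* q i (p ∸ i))) (ℕP.*-assoc (q ^ i) _ Z))

  b-split : ∀ j lam x → j ≤ lam → b q m F lam x ≡ b q m F j x ℤ.+ b q m F (lam ∸ j) (x /q^ j)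
  b-split j lam x j≤lam = trans
    (cong (λ l → sumℤ 0 l _) (sym (ℕP.m+[n∸m]≡n j≤lam)))
    (trans (sumℤ-++ 0 j (lam ∸ j) _)
      (cong (λ z → b q m F j x ℤ.+ z) (sumℤ-cong j 0 (lam ∸ j) (λ i _ →
        cong (Fn q m F) (sym (/q^-/q^ x j i))))))

  -- b_j only reads digits below j + m - 1, so it is q^(j+m-1)-periodic.
  b-periodic : ∀ j N Z → b q m F j (N ℕ.+ q ^ j ℕ.* (q ^ (m ∸ 1) ℕ.* Z)) ≡ b q m F j N
  b-periodic j N Z = sumℤ-cong 0 0 j (λ i i<j → begin
    Fn q m F ((N ℕ.+ q ^ j ℕ.* (q ^ (m ∸ 1) ℕ.* Z)) /q^ i)
      ≡⟨ cong (λ y → Fn q m F ((N ℕ.+ y) /q^ i)) merge ⟩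
    Fn q m F ((N ℕ.+ q ^ p ℕ.* Z) /q^ i)
      ≡⟨ cong (Fn q m F) (/q^-+-high N Z (ℕP.≤-trans (ℕP.<⇒≤ i<j) (ℕP.m≤m+n j (m ∸ 1)))) ⟩
    Fn q m F (N /q^ i ℕ.+ q ^ (p ∸ i) ℕ.* Z)
      ≡⟨ Fn-+-high (N /q^ i) Z (bound i<j) ⟩
    Fn q m F (N /q^ i) ∎)
    where
    open ≡-Reasoning
    p = j ℕ.+ (m ∸ 1)
    merge : q ^ j ℕ.* (q ^ (m ∸ 1) ℕ.* Z) ≡ q ^ p ℕ.* Z
    merge = trans (sym (ℕP.*-assoc (q ^ j) _ Z))
                  (cong (ℕ._* Z) (sym (ℕP.^-distribˡ-+-* q j (m ∸ 1))))
    bound : ∀ {i} → i < j → m ∸ 1 < p ∸ i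
    bound {i} i<j = ℕP.m+n≤o⇒m≤o∸n (suc (m ∸ 1))
      (ℕP.≤-trans (ℕP.≤-reflexive (cong suc (ℕP.+-comm (m ∸ 1) i))) (ℕP.+-monoˡ-≤ (m ∸ 1) i<j))

phaseB-split : ∀ q .{{_ : NonZero q}} m F m' .{{_ : NonZero m'}} k a lam j r
                 (x y z : Fin k → ℕ) →
               (∀ ℓ → b q m F lam (x ℓ) ≡ b q m F j (y ℓ) ℤ.+ b q m F r (z ℓ)) →
               phaseB q m F m' k a lam x
                 ≡ phaseB q m F m' k a j y ℚ.+ phaseB q m F m' k a r z
phaseB-split q m F m' k a lam j r x y z b-eq =
  trans (sumFinℚ-cong k term) (sumFinℚ-+ k _ _)
  where
  α : Fin k → ℤ
  α ℓ = + toℕ (a ℓ)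
  term : ∀ ℓ → (α ℓ ℤ.* b q m F lam (x ℓ)) ℚ./ m'
             ≡ (α ℓ ℤ.* b q m F j (y ℓ)) ℚ./ m' ℚ.+ (α ℓ ℤ.* b q m F r (z ℓ)) ℚ./ m'
  term ℓ = trans (cong (λ t → (α ℓ ℤ.* t) ℚ./ m') (b-eq ℓ))
    (trans (cong (ℚ._/ m') (ℤP.*-distribˡ-+ (α ℓ) (b q m F j (y ℓ)) (b q m F r (z ℓ))))
      (/-distribʳ-+ (α ℓ ℤ.* b q m F j (y ℓ)) (α ℓ ℤ.* b q m F r (z ℓ)) m'))

module Decomposition
  (q : ℕ) .{{_ : NonZero q}} (m : ℕ) (F : Vec (Fin q) m → ℤ)
  (m' : ℕ) .{{_ : NonZero m'}} (k : ℕ) (a : Fin k → Fin m')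
  {c ℓr : Level} (R : CommutativeRing c ℓr)
  (e : ℚ → CommutativeRing.Carrier R)
  (e-+ : ∀ x y → CommutativeRing._≈_ R (e (x ℚ.+ y)) (CommutativeRing._*_ R (e x) (e y)))
  (qinv : CommutativeRing.Carrier R) (I : Fin k → ℕ) (h : ℤ) (d lam j : ℕ) (j≤lam : j ≤ lam)
  (δ : ℕ)
  where

  open CommutativeRing R
    renaming (refl to ≈-refl; sym to ≈-sym; trans to ≈-trans; reflexive to ≈-reflexive)
  open FiniteSums R
  open Digits q m F
  module ≈-Reasoning = SetoidReasoning setoid

  r P M Q L : ℕ
  r = lam ∸ j
  P = q ^ j
  M = q ^ r
  Q = q ^ (m ∸ 1)
  L = q ^ lam

  instance
    P≢0 : NonZero P
    P≢0 = m^n≢0 q j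
    M≢0 : NonZero M
    M≢0 = m^n≢0 q r
    L≢0 : NonZero L
    L≢0 = m^n≢0 q lam

  lam-split : j ℕ.+ r ≡ lam
  lam-split = ℕP.m+[n∸m]≡n j≤lam

  L-split : L ≡ P ℕ.* M
  L-split = trans (cong (q ^_) (sym lam-split)) (ℕP.^-distribˡ-+-* q j r)

  phase : ℕ → (Fin k → ℕ) → ℚ
  phase = phaseB q m F m' k a

  -- Arguments of b_λ in G_λ^I(h, P d + δ), of b_j in v^j(I,ε,δ),
  -- and of b_(λ-j) in G_(λ-j)^(T(I))(h,d).
  X : ℕ → Fin k → ℕ
  X u ℓ = Q ℕ.* (u ℕ.+ toℕ ℓ ℕ.* (P ℕ.* d ℕ.+ δ)) ℕ.+ I ℓ
  N : ℕ → Fin k → ℕ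
  N ε ℓ = I ℓ ℕ.+ Q ℕ.* (ε ℕ.+ toℕ ℓ ℕ.* δ)
  Y : ℕ → ℕ → Fin k → ℕ
  Y ε u' ℓ = Q ℕ.* (u' ℕ.+ toℕ ℓ ℕ.* d) ℕ.+ T q m k j ε δ I ℓ

  summand : ℕ → Carrier
  summand u = e (phase lam (X u) ℚ.- (h ℤ.* + u) ℚ./ L)
  summand' : ℕ → ℕ → Carrier
  summand' ε u' = e (phase r (Y ε u') ℚ.- (h ℤ.* + u') ℚ./ M)
  twist : ℕ → Carrier
  twist ε = e (ℚ.- ((h ℤ.* + ε) ℚ./ L))
  vε : ℕ → Carrier
  vε ε = v R q m F m' k a e j I ε δ

  position-split : ∀ ε u' ℓ → X (ε ℕ.+ P ℕ.* u') ℓ ≡ N ε ℓ ℕ.+ P ℕ.* (Q ℕ.* (u' ℕ.+ toℕ ℓ ℕ.* d))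
  position-split ε u' ℓ = identity Q ε P u' (toℕ ℓ) d δ (I ℓ)
    where
    identity : ∀ Q ε P u t d δ i →
      Q ℕ.* ((ε ℕ.+ P ℕ.* u) ℕ.+ t ℕ.* (P ℕ.* d ℕ.+ δ)) ℕ.+ i
        ≡ (i ℕ.+ Q ℕ.* (ε ℕ.+ t ℕ.* δ)) ℕ.+ P ℕ.* (Q ℕ.* (u ℕ.+ t ℕ.* d))
    identity = ℕSolver.solve-∀

  b-decomposition : ∀ ε u' ℓ →
    b q m F lam (X (ε ℕ.+ P ℕ.* u') ℓ) ≡ b q m F j (N ε ℓ) ℤ.+ b q m F r (Y ε u' ℓ)
  b-decomposition ε u' ℓ = begin
    b q m F lam (X (ε ℕ.+ P ℕ.* u') ℓ)
      ≡⟨ cong (b q m F lam) (position-split ε u' ℓ) ⟩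
    b q m F lam (N ε ℓ ℕ.+ P ℕ.* W)
      ≡⟨ b-split j lam _ j≤lam ⟩
    b q m F j (N ε ℓ ℕ.+ P ℕ.* W) ℤ.+ b q m F r ((N ε ℓ ℕ.+ P ℕ.* W) /q^ j)
      ≡⟨ cong₂ ℤ._+_ (b-periodic j (N ε ℓ) (u' ℕ.+ toℕ ℓ ℕ.* d))
                     (cong (b q m F r) (trans (/q^-+-* (N ε ℓ) W j) (ℕP.+-comm _ W))) ⟩
    b q m F j (N ε ℓ) ℤ.+ b q m F r (Y ε u' ℓ) ∎
    where
    open ≡-Reasoning
    W = Q ℕ.* (u' ℕ.+ toℕ ℓ ℕ.* d)

  phase-decomposition : ∀ ε u' →
    phase lam (X (ε ℕ.+ P ℕ.* u')) ℚ.- (h ℤ.* + (ε ℕ.+ P ℕ.* u')) ℚ./ L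
      ≡ (ℚ.- ((h ℤ.* + ε) ℚ./ L) ℚ.+ phase j (N ε))
        ℚ.+ (phase r (Y ε u') ℚ.- (h ℤ.* + u') ℚ./ M)
  phase-decomposition ε u' = trans
    (cong₂ ℚ._-_ (phaseB-split q m F m' k a lam j r _ (N ε) (Y ε u') (b-decomposition ε u'))
                 (fracSplit h ε u' P M L L-split))
    (regroup (phase j (N ε)) (phase r (Y ε u')) ((h ℤ.* + ε) ℚ./ L) ((h ℤ.* + u') ℚ./ M))
    where
    regroup : ∀ x y z w → (x ℚ.+ y) ℚ.- (z ℚ.+ w) ≡ (ℚ.- z ℚ.+ x) ℚ.+ (y ℚ.- w)
    regroup = solve 4 (λ x y z w → (x :+ y) :- (z :+ w) := (:- z :+ x) :+ (y :- w)) refl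

  summand-factorisation : ∀ ε u' → summand (ε ℕ.+ P ℕ.* u') ≈ twist ε * vε ε * summand' ε u'
  summand-factorisation ε u' = ≈-trans (≈-reflexive (cong e (phase-decomposition ε u')))
                                       (≈-trans (e-+ _ _) (*-congʳ (e-+ _ _)))

  inner-sum : ∀ ε → powR R qinv r * sumR R M (λ u' → summand (ε ℕ.+ P ℕ.* u'))
                  ≈ twist ε * vε ε * (powR R qinv r * sumR R M (summand' ε))
  inner-sum ε = begin
    powR R qinv r * sumR R M (λ u' → summand (ε ℕ.+ P ℕ.* u'))
      ≈⟨ *-congˡ (sumR-cong M (summand-factorisation ε)) ⟩
    powR R qinv r * sumR R M (λ u' → twist ε * vε ε * summand' ε u')
      ≈⟨ *-congˡ (≈-sym (sumR-*-distribˡ M (twist ε * vε ε) (summand' ε))) ⟩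
    powR R qinv r * (twist ε * vε ε * sumR R M (summand' ε))
      ≈⟨ x*[y*z]≈y*[x*z] _ _ _ ⟩
    twist ε * vε ε * (powR R qinv r * sumR R M (summand' ε)) ∎
    where
    open ≈-Reasoning
    x*[y*z]≈y*[x*z] : ∀ x y z → x * (y * z) ≈ y * (x * z)
    x*[y*z]≈y*[x*z] x y z =
      ≈-trans (≈-sym (*-assoc x y z)) (≈-trans (*-congʳ (*-comm x y)) (*-assoc y x z))

  G-decomposition :
    G R q m F m' k a e qinv lam I h (P ℕ.* d ℕ.+ δ)
      ≈ powR R qinv j *
        sumR R P (λ ε → twist ε * vε ε * G R q m F m' k a e qinv r (T q m k j ε δ I) h d)
  G-decomposition = begin
    powR R qinv lam * sumR R L summand
      ≈⟨ *-cong (≈-trans (≈-reflexive (cong (powR R qinv) (sym lam-split))) (powR-+ qinv j r))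
                (≈-trans (sumR-length summand L-split) (sumR-digits P M summand)) ⟩
    (powR R qinv j * powR R qinv r) * sumR R P (λ ε → sumR R M (λ u' → summand (ε ℕ.+ P ℕ.* u')))
      ≈⟨ *-assoc _ _ _ ⟩
    powR R qinv j * (powR R qinv r * sumR R P (λ ε → sumR R M (λ u' → summand (ε ℕ.+ P ℕ.* u'))))
      ≈⟨ *-congˡ (sumR-*-distribˡ P _ _) ⟩
    powR R qinv j * sumR R P (λ ε → powR R qinv r * sumR R M (λ u' → summand (ε ℕ.+ P ℕ.* u')))
      ≈⟨ *-congˡ (sumR-cong P inner-sum) ⟩
    powR R qinv j * sumR R P (λ ε → twist ε * vε ε * (powR R qinv r * sumR R M (summand' ε))) ∎
    where open ≈-Reasoning

lemma10 : (q : ℕ) .{{_ : NonZero q}} → 2 ≤ q →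
    (m : ℕ) → 1 ≤ m →
    (F : Vec (Fin q) m → ℤ) →
    F (replicate m (0 mod q)) ≡ + 0 →
    (∀ (n : ℕ) → sumℤ 1 (m ∸ 1) (λ j → Fn q m F (n ℕ.* q ^ j)) ≡ + 0) →
    (m' : ℕ) .{{_ : NonZero m'}} →
    (k : ℕ) → 1 ≤ k →
    (a : Fin k → Fin m') →
    ∀ {c ℓr : Level} (R : CommutativeRing c ℓr) →
    let open CommutativeRing R in
    (e : ℚ → Carrier) → IsCharacter R e →
    (qinv : Carrier) → natR R q * qinv ≈ 1# →
    (I : Fin k → ℕ) → InI q m k I →
    (h : ℤ) (d lam j : ℕ) → 1 ≤ j → j ≤ lam →
    (δ : ℕ) → δ < q ^ j →
    G R q m F m' k a e qinv lam I h (q ^ j ℕ.* d ℕ.+ δ)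
      ≈ powR R qinv j *
        sumR R (q ^ j) (λ ε →
          e (ℚ.- ((h ℤ.* + ε) ℚ./ (q ^ lam)) {{m^n≢0 q lam}})
          * v R q m F m' k a e j I ε δ
          * G R q m F m' k a e qinv (lam ∸ j) (T q m k j ε δ I) h d)
lemma10 q _ m _ F _ _ m' k _ a R e (e-+ , _) qinv _ I _ h d lam j _ j≤lam δ _ =
  Decomposition.G-decomposition q m F m' k a R e e-+ qinv I h d lam j j≤lam δ
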